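{- Let $n\in\mathbb{N}^\ast$, with $\mathcal{S}$, $\rho$, $T$, $\mathbf{u}$, $\boldsymbol{\mu}$ as in the context, and set $\mathcal{U}=T\rho(\mathbf{u})$, $\mathcal{M}=T\rho(\boldsymbol{\mu})$. Then $$\mathcal{U}=\big(\lfloor n/(ij)\rfloor\big)_{i,j\in\mathcal{S}}\quad\text{and}\quad\mathcal{M}=\big(M(\lfloor n/(ij)\rfloor)\big)_{i,j\in\mathcal{S}},$$ where $M$ is the Mertens function.
   Context: Fix $n\in\mathbb{N}^\ast$ and define $i\,\mathcal{R}\,j\iff\lfloor n/i\rfloor=\lfloor n/j\rfloor$ on $\mathbb{N}^\ast$; its classes are intervals, the integers $>n$ form the only unbounded class. $\mathcal{S}$ is the set of largest elements of the bounded classes, $s=\#\mathcal{S}$, $\mathcal{S}=\{s_1<\dots<s_s\}$; for $k\in\mathcal{S}$, $k^-$ is its predecessor in $\mathcal{S}$ ($1^-=0$). $\boldsymbol{\mathcal{A}}$ is the free $\mathbb{Z}$-module with basis $\{\mathbf{k}:k\in\mathcal{S}\}$, made into a commutative $\mathbb{Z}$-algebra by: $\mathbf{i}\mathbf{j}=\mathbf{l}$ if $ij\le n$, where $l\in\mathcal{S}$ is the largest element of the class of $ij$, and $\mathbf{i}\mathbf{j}=0$ if $ij>n$. For $\mathbf{a}\in\boldsymbol{\mathcal{A}}$, $\rho(\mathbf{a})$ is the $s\times s$ matrix, indexed by $\mathcal{S}$ in increasing order, of $\mathbf{x}\mapsto\mathbf{a}\mathbf{x}$ in the basis $(\mathbf{k})_{k\in\mathcal{S}}$.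 $T$ is the $s\times s$ matrix with $T_{s_p,s_q}=1$ if $p+q\le s+1$ and $0$ otherwise. $\mathbf{u}=\sum_{k\in\mathcal{S}}(k-k^-)\mathbf{k}$ and $\boldsymbol{\mu}=\sum_{k\in\mathcal{S}}(M(k)-M(k^-))\mathbf{k}$, where $M(x)=\sum_{1\le m\le x}\mu(m)$ is the Mertens function with $M(0)=0$ and $\mu$ the Möbius function. -}

module Defs where

open import Data.Nat as ℕ using (ℕ; zero; suc; _≤?_; _≟_)
open import Data.Nat.DivMod using (_/_)
open import Data.Nat.Divisibility using (_∣?_)
open import Data.Nat.Primality using (prime?)
open import Data.Integer as ℤ using (ℤ; +_; -_; _-_)
open import Data.Fin as Fin using (Fin; toℕ)
open import Data.List as List using (List; length; filter; applyUpTo; findIndex)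
open import Data.Maybe using (Maybe; just; nothing)
open import Data.Bool using (if_then_else_)
open import Relation.Nullary using (¬?; does)
open import Relation.Nullary.Decidable using (_×-dec_)
open import Data.Product using (_×_)
open import Data.Bool.ListAction using (any)

-- ⌊ n / m ⌋ ; the value at m = 0 is irrelevant (only used with m ≥ 1)
div : ℕ → ℕ → ℕ
div n zero    = 0
div n (suc m) = n / suc m

Σ : (s : ℕ) → (Fin s → ℤ) → ℤ
Σ zero    f = + 0
Σ (suc s) f = f Fin.zero ℤ.+ Σ s (λ i → f (Fin.suc i))

hasSquareFactor : ℕ → Data.Bool.Bool
hasSquareFactor m = any (λ d → does ((d ℕ.* d) ∣? m)) (applyUpTo (λ i → suc (suc i)) m)

ω : ℕ → ℕ
ω m = length (filter (λ p → prime? p ×-dec (p ∣? m)) (applyUpTo suc m))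

sgnPow : ℕ → ℤ
sgnPow zero    = + 1
sgnPow (suc k) = - sgnPow k

μ : ℕ → ℤ
μ m = if hasSquareFactor m then + 0 else sgnPow (ω m)

Mertens : ℕ → ℤ
Mertens zero    = + 0
Mertens (suc x) = Mertens x ℤ.+ μ (suc x)

-- The set S (increasing list) of largest elements of the bounded classes
-- of i R j ⟺ ⌊n/i⌋ = ⌊n/j⌋.  The bounded classes consist of 1 … n;
-- k ∈ {1..n} is the largest element of its class iff ⌊n/k⌋ ≠ ⌊n/(k+1)⌋.

SList : ℕ → List ℕ
SList n = filter (λ k → ¬? (div n k ≟ div n (suc k))) (applyUpTo suc n)

sz : ℕ → ℕ
sz n = length (SList n)

-- s_p, p : Fin s (0-indexed)
el : (n : ℕ) → Fin (sz n) → ℕ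
el n = List.lookup (SList n)

-- k⁻ : predecessor of s_p in S (1⁻ = 0)
predAt : (xs : List ℕ) → Fin (length xs) → ℕ
predAt (x List.∷ xs) Fin.zero    = 0
predAt (x List.∷ xs) (Fin.suc p) = List.lookup (x List.∷ xs) (Fin.inject₁ p)

pred⁻ : (n : ℕ) → Fin (sz n) → ℕ
pred⁻ n = predAt (SList n)

-- The algebra 𝒜: elements are coordinate vectors in the basis (𝐤)_{k∈S}

Elt : ℕ → Set
Elt n = Fin (sz n) → ℤ

basis : (n : ℕ) → Fin (sz n) → Elt n
basis n p q with Fin._≟_ p q
... | Relation.Nullary.yes _ = + 1
... | Relation.Nullary.no  _ = + 0
  where import Relation.Nullary

classIdx : (n : ℕ) → ℕ → Maybe (Fin (sz n))
classIdx n m = findIndex (λ l → div n l ≟ div n m) (SList n)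

basisMul : (n : ℕ) → Fin (sz n) → Fin (sz n) → Elt n
basisMul n p q with el n p ℕ.* el n q ≤? n
... | Relation.Nullary.no _  = λ _ → + 0
  where import Relation.Nullary
... | Relation.Nullary.yes _ with classIdx n (el n p ℕ.* el n q)
...   | just l  = basis n l
...   | nothing = λ _ → + 0

mul : (n : ℕ) → Elt n → Elt n → Elt n
mul n a b r = Σ (sz n) (λ p → Σ (sz n) (λ q → a p ℤ.* b q ℤ.* basisMul n p q r))

ρ : (n : ℕ) → Elt n → Fin (sz n) → Fin (sz n) → ℤ
ρ n a p q = mul n a (basis n q) p

-- T_{s_p,s_q} = 1 iff p + q ≤ s + 1 (1-indexed), i.e. toℕ p + toℕ q < s (0-indexed)
Tmat : (n : ℕ) → Fin (sz n) → Fin (sz n) → ℤ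
Tmat n p q = if does (suc (toℕ p ℕ.+ toℕ q) ≤? sz n) then + 1 else + 0

matMul : (s : ℕ) → (Fin s → Fin s → ℤ) → (Fin s → Fin s → ℤ) → Fin s → Fin s → ℤ
matMul s A B i j = Σ s (λ k → A i k ℤ.* B k j)

𝐮 : (n : ℕ) → Elt n
𝐮 n p = + el n p - + pred⁻ n p

𝛍 : (n : ℕ) → Elt n
𝛍 n p = Mertens (el n p) - Mertens (pred⁻ n p)

𝒰 : (n : ℕ) → Fin (sz n) → Fin (sz n) → ℤ
𝒰 n = matMul (sz n) (Tmat n) (ρ n (𝐮 n))

𝓜 : (n : ℕ) → Fin (sz n) → Fin (sz n) → ℤ
𝓜 n = matMul (sz n) (Tmat n) (ρ n (𝛍 n))

module Submission where

-- Expanding ρ(a) in the basis, (T ρ(a))_{ij} = Σ_p a_p (T ρ(𝐩))_{ij}, and (T ρ(𝐩))_{ij}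
-- is T_{i,l} when 𝐩𝐣 = 𝐥 (and 0 when s_p s_j > n). The map k ↦ ⌊n/k⌋ is a strictly
-- decreasing self-map of S, so it sends s_q to s_{s+1-q}; hence T_{s_i,s_l} = 1 exactly
-- when s_i s_l ≤ n, which, l lying in the class of s_p s_j, says s_p ≤ ⌊n/(s_i s_j)⌋.
-- For a = Σ_k (g(k) - g(k⁻)) 𝐤 the sum over p therefore telescopes to
-- g(⌊n/(s_i s_j)⌋) - g(0), as ⌊n/(s_i s_j)⌋ is 0 or lies in S. Both 𝐮 and 𝛍 have this
-- shape, with g = id and g = M.

open import Defs
open import Data.Nat
  using (ℕ; zero; suc; _≤_; _<_; _+_; _*_; z≤n; s≤s; s≤s⁻¹; _≤?_; _≟_; >-nonZero)
open import Data.Nat.Properties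
open import Data.Nat.DivMod using (_/_; m*n/n≡m; /-monoˡ-≤; m/n*n≤m; m/n≤m)
open import Data.Integer as ℤ using (ℤ; +_; _-_)
import Data.Integer.Properties as ℤᵖ
open import Data.Integer.Tactic.RingSolver using (solve-∀)
open import Data.Fin as Fin using (Fin; zero; suc; toℕ; inject₁)
import Data.Fin.Properties as Finᵖ
open import Data.Fin.Induction using (<-weakInduction; >-weakInduction)
open import Data.List using (List; _∷_; length; lookup; findIndex; applyUpTo)
open import Data.List.Relation.Unary.All as All using (All)
open import Data.List.Relation.Unary.Any as Any using (Any; here; there)
open import Data.List.Relation.Unary.Any.Properties using (lookup-index)
open import Data.List.Relation.Unary.AllPairs using (AllPairs; _∷_)
import Data.List.Relation.Unary.AllPairs.Properties as AllPairsᵖ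
open import Data.List.Membership.Propositional using (_∈_; lose)
open import Data.List.Membership.Propositional.Properties
  using (∈-filter⁺; ∈-filter⁻; ∈-applyUpTo⁺; ∈-applyUpTo⁻; ∈-lookup)
open import Data.Maybe using (just; nothing)
open import Data.Bool using (Bool; if_then_else_)
open import Data.Product using (_×_; _,_; proj₁; proj₂)
open import Data.Sum using (inj₁; inj₂)
open import Function using (_∘_; _⇔_; mk⇔)
open import Function.Properties.Equivalence using (⇔-setoid)
open import Level using (0ℓ)
open import Relation.Binary.PropositionalEquality
open import Relation.Nullary using (yes; no; does; ¬?; contradiction)
open import Relation.Nullary.Decidable using (dec-true; dec-false; does-⇔)
open import Relation.Unary using (Pred; Decidable)
import Relation.Binary.Reasoning.Setoid as SetoidReasoning
import Algebra.Properties.CommutativeSemigroup as CommSemigroupᵖ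
open import Algebra.Properties.Semiring.Sum ℤᵖ.+-*-semiring
  using (sum; sum-cong-≗; ∑-comm; *-distribˡ-sum)

module ⇔-Reasoning = SetoidReasoning (⇔-setoid 0ℓ)
module ℕ* = CommSemigroupᵖ *-commutativeSemigroup
module ℤ* = CommSemigroupᵖ ℤᵖ.*-commutativeSemigroup

≤div⇒*≤ : ∀ n d {k} → k ≤ div n d → k * d ≤ n
≤div⇒*≤ n zero    {k} _   = ≤-trans (≤-reflexive (*-zeroʳ k)) z≤n
≤div⇒*≤ n (suc d) {k} k≤q = ≤-trans (*-monoˡ-≤ (suc d) k≤q) (m/n*n≤m n (suc d))

*≤⇒≤div : ∀ n {d k} → 1 ≤ d → k * d ≤ n → k ≤ div n d
*≤⇒≤div n {suc d} {k} _ kd≤n =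
  subst (_≤ n / suc d) (m*n/n≡m k (suc d)) (/-monoˡ-≤ (suc d) kd≤n)

≤div⇔*≤ : ∀ n {d k} → 1 ≤ d → k ≤ div n d ⇔ k * d ≤ n
≤div⇔*≤ n {d} 1≤d = mk⇔ (≤div⇒*≤ n d) (*≤⇒≤div n 1≤d)

div≤ : ∀ n d → div n d ≤ n
div≤ n zero    = z≤n
div≤ n (suc d) = m/n≤m n (suc d)

div-positive : ∀ n {d} → 1 ≤ d → d ≤ n → 1 ≤ div n d
div-positive n {d} 1≤d d≤n = *≤⇒≤div n 1≤d (≤-trans (≤-reflexive (*-identityˡ d)) d≤n)

div-antitone : ∀ n {d d′} → 1 ≤ d → d ≤ d′ → div n d′ ≤ div n d
div-antitone n {d} {d′} 1≤d d≤d′ =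
  *≤⇒≤div n 1≤d (≤-trans (*-monoʳ-≤ (div n d′) d≤d′) (≤div⇒*≤ n d′ ≤-refl))

≤div-div : ∀ n {d} → 1 ≤ d → d ≤ n → d ≤ div n (div n d)
≤div-div n {d} 1≤d d≤n = *≤⇒≤div n (div-positive n 1≤d d≤n)
  (≤-trans (≤-reflexive (*-comm d (div n d))) (≤div⇒*≤ n d ≤-refl))

div-div-div : ∀ n {d} → 1 ≤ d → d ≤ n → div n (div n (div n d)) ≡ div n d
div-div-div n {d} 1≤d d≤n = ≤-antisym
  (div-antitone n 1≤d (≤div-div n 1≤d d≤n))
  (≤div-div n (div-positive n 1≤d d≤n) (div≤ n d))

IsClassMax : ℕ → ℕ → Set
IsClassMax n k = div n k ≢ div n (suc k)

isClassMax? : ∀ n → Decidable (IsClassMax n)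
isClassMax? n k = ¬? (div n k ≟ div n (suc k))

div-isClassMax : ∀ n {d} → 1 ≤ d → d ≤ n → IsClassMax n (div n d)
div-isClassMax n {d} 1≤d d≤n q≡q⁺ = n≮n q (*≤⇒≤div n 1≤d (begin
  suc q * d  ≡⟨ *-comm (suc q) d ⟩
  d * suc q  ≤⟨ ≤div⇒*≤ n (suc q) (subst (d ≤_) q≡q⁺ (≤div-div n 1≤d d≤n)) ⟩
  n          ∎))
  where
  q = div n d
  open ≤-Reasoning

isClassMax⇒div-< : ∀ n {k k′} → IsClassMax n k → 1 ≤ k → k < k′ → div n k′ < div n k
isClassMax⇒div-< n {k} max 1≤k k<k′ = ≤-<-trans (div-antitone n (s≤s z≤n) k<k′)
  (≤∧≢⇒< (div-antitone n 1≤k (n≤1+n k)) (max ∘ sym))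

∈SList⇒ : ∀ n {v} → v ∈ SList n → 1 ≤ v × v ≤ n × IsClassMax n v
∈SList⇒ n v∈S with ∈-filter⁻ (isClassMax? n) {xs = applyUpTo suc n} v∈S
... | v∈range , max with ∈-applyUpTo⁻ suc v∈range
... | _ , v<n , refl = s≤s z≤n , v<n , max

∈SList⁺ : ∀ n {v} → 1 ≤ v → v ≤ n → IsClassMax n v → v ∈ SList n
∈SList⁺ n {suc v} _ v<n max = ∈-filter⁺ (isClassMax? n) (∈-applyUpTo⁺ suc v<n) max

div∈SList : ∀ n {d} → 1 ≤ d → d ≤ n → div n d ∈ SList n
div∈SList n {d} 1≤d d≤n =
  ∈SList⁺ n (div-positive n 1≤d d≤n) (div≤ n d) (div-isClassMax n 1≤d d≤n)

div∈0∷SList : ∀ n {d} → 1 ≤ d → div n d ∈ 0 ∷ SList n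
div∈0∷SList n {d} 1≤d with div n d ≟ 0
... | yes q≡0 = here q≡0
... | no  q≢0 = there (div∈SList n 1≤d
  (≤-trans (≤-reflexive (sym (*-identityˡ d))) (≤div⇒*≤ n d (n≢0⇒n>0 q≢0))))

SList-increasing : ∀ n → AllPairs _<_ (SList n)
SList-increasing n =
  AllPairsᵖ.filter⁺ (isClassMax? n) (AllPairsᵖ.applyUpTo⁺₁ suc n (λ i<j _ → s≤s i<j))

lookup-AllPairs : ∀ {A : Set} {R : A → A → Set} {xs : List A} → AllPairs R xs →
                  ∀ {i j} → i Fin.< j → R (lookup xs i) (lookup xs j)
lookup-AllPairs (x<xs ∷ _)  {zero}  {suc j} _         = All.lookup x<xs (∈-lookup j)
lookup-AllPairs (_ ∷ sorted) {suc i} {suc j} (s≤s i<j) = lookup-AllPairs sorted i<j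

module StrictlyIncreasing {s : ℕ} {f : Fin s → ℕ}
                          (increasing : ∀ {i j} → i Fin.< j → f i < f j) where

  mono-≤ : ∀ {i j} → i Fin.≤ j → f i ≤ f j
  mono-≤ i≤j with m≤n⇒m<n∨m≡n i≤j
  ... | inj₁ i<j = <⇒≤ (increasing i<j)
  ... | inj₂ i≡j = ≤-reflexive (cong f (Finᵖ.toℕ-injective i≡j))

  cancel-≤ : ∀ {i j} → f i ≤ f j → i Fin.≤ j
  cancel-≤ fi≤fj = ≮⇒≥ (λ j<i → <⇒≱ (increasing j<i) fi≤fj)

  cancel-< : ∀ {i j} → f i < f j → i Fin.< j
  cancel-< fi<fj = ≰⇒> (λ j≤i → <⇒≱ fi<fj (mono-≤ j≤i))

strictlyAntitone⇒complement : ∀ {s} {f : Fin s → Fin s} →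
  (∀ {i j} → i Fin.< j → f j Fin.< f i) → ∀ i → suc (toℕ i + toℕ (f i)) ≡ s
strictlyAntitone⇒complement {suc s} {f} antitone i = cong suc (≤-antisym (upper i) (lower i))
  where
  open ≤-Reasoning
  shift : ∀ i → suc (toℕ i + toℕ (f (suc i))) ≤ toℕ (inject₁ i) + toℕ (f (inject₁ i))
  shift i = begin
    suc (toℕ i + toℕ (f (suc i)))          ≡⟨ +-suc (toℕ i) _ ⟨
    toℕ i + suc (toℕ (f (suc i)))          ≤⟨ +-monoʳ-≤ (toℕ i) (antitone (Finᵖ.≤̄⇒inject₁< ≤-refl)) ⟩
    toℕ i + toℕ (f (inject₁ i))            ≡⟨ cong (_+ toℕ (f (inject₁ i))) (Finᵖ.toℕ-inject₁ i) ⟨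
    toℕ (inject₁ i) + toℕ (f (inject₁ i))  ∎
  upper : ∀ i → toℕ i + toℕ (f i) ≤ s
  upper = <-weakInduction _ (Finᵖ.toℕ≤pred[n] (f zero)) (λ i ih → ≤-trans (shift i) ih)
  lower : ∀ i → s ≤ toℕ i + toℕ (f i)
  lower = >-weakInduction _
    (≤-trans (≤-reflexive (sym (Finᵖ.toℕ-fromℕ s))) (m≤m+n _ _))
    (λ i ih → ≤-trans ih (shift i))

findIndex-sound : ∀ {A : Set} {P : Pred A 0ℓ} (P? : Decidable P) {xs i} →
                  findIndex P? xs ≡ just i → P (lookup xs i)
findIndex-sound P? {x ∷ xs} eq with P? x
findIndex-sound P? {x ∷ xs} {zero} refl | yes px = px
findIndex-sound P? {x ∷ xs} eq | no _ with findIndex P? xs in found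
findIndex-sound P? {x ∷ xs} {suc i} refl | no _ | just _ = findIndex-sound P? {xs} found

findIndex-complete : ∀ {A : Set} {P : Pred A 0ℓ} (P? : Decidable P) {xs} →
                     Any P xs → findIndex P? xs ≢ nothing
findIndex-complete P? {x ∷ xs} any with P? x | any
... | yes _  | _        = λ ()
... | no ¬px | here px  = contradiction px ¬px
... | no _   | there any′ with findIndex P? xs | findIndex-complete P? any′
...   | just _  | _         = λ ()
...   | nothing | ≢nothing = contradiction refl ≢nothing

Σ≡sum : ∀ s (f : Fin s → ℤ) → Σ s f ≡ sum f
Σ≡sum zero    f = refl
Σ≡sum (suc s) f = cong (ℤ._+_ (f zero)) (Σ≡sum s (f ∘ suc))

Σ-cong : ∀ s {f g : Fin s → ℤ} → (∀ i → f i ≡ g i) → Σ s f ≡ Σ s g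
Σ-cong zero    f≗g = refl
Σ-cong (suc s) f≗g = cong₂ ℤ._+_ (f≗g zero) (Σ-cong s (f≗g ∘ suc))

Σ-zero : ∀ s {f : Fin s → ℤ} → (∀ i → f i ≡ + 0) → Σ s f ≡ + 0
Σ-zero zero    f≗0 = refl
Σ-zero (suc s) f≗0 = cong₂ ℤ._+_ (f≗0 zero) (Σ-zero s (f≗0 ∘ suc))

Σ-pick : ∀ s {f : Fin s → ℤ} (j : Fin s) → (∀ i → j ≢ i → f i ≡ + 0) → Σ s f ≡ f j
Σ-pick (suc s) {f} zero off =
  trans (cong (ℤ._+_ (f zero)) (Σ-zero s (λ i → off (suc i) (λ ())))) (ℤᵖ.+-identityʳ _)
Σ-pick (suc s) {f} (suc j) off =
  trans (cong₂ ℤ._+_ (off zero (λ ()))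
                     (Σ-pick s j (λ i j≢i → off (suc i) (j≢i ∘ Finᵖ.suc-injective))))
        (ℤᵖ.+-identityˡ _)

*-distribˡ-Σ : ∀ s c (f : Fin s → ℤ) → c ℤ.* Σ s f ≡ Σ s (λ i → c ℤ.* f i)
*-distribˡ-Σ s c f = begin
  c ℤ.* Σ s f              ≡⟨ cong (c ℤ.*_) (Σ≡sum s f) ⟩
  c ℤ.* sum f              ≡⟨ *-distribˡ-sum c f ⟩
  sum (λ i → c ℤ.* f i)    ≡⟨ Σ≡sum s _ ⟨
  Σ s (λ i → c ℤ.* f i)    ∎
  where open ≡-Reasoning

Σ-comm : ∀ s t (f : Fin s → Fin t → ℤ) →
         Σ s (λ i → Σ t (λ j → f i j)) ≡ Σ t (λ j → Σ s (λ i → f i j))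
Σ-comm s t f = begin
  Σ s (λ i → Σ t (f i))            ≡⟨ Σ≡sum s _ ⟩
  sum (λ i → Σ t (f i))            ≡⟨ sum-cong-≗ (λ i → Σ≡sum t (f i)) ⟩
  sum (λ i → sum (f i))            ≡⟨ ∑-comm f ⟩
  sum (λ j → sum (λ i → f i j))    ≡⟨ sum-cong-≗ (λ j → Σ≡sum s (λ i → f i j)) ⟨
  sum (λ j → Σ s (λ i → f i j))    ≡⟨ Σ≡sum t _ ⟨
  Σ t (λ j → Σ s (λ i → f i j))    ∎
  where open ≡-Reasoning

el-positive : ∀ n p → 1 ≤ el n p
el-positive n p = proj₁ (∈SList⇒ n (∈-lookup p))

el*el-positive : ∀ n p q → 1 ≤ el n p * el n q
el*el-positive n p q = *-mono-≤ (el-positive n p) (el-positive n q)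

el≤n : ∀ n p → el n p ≤ n
el≤n n p = proj₁ (proj₂ (∈SList⇒ n (∈-lookup p)))

el-isClassMax : ∀ n p → IsClassMax n (el n p)
el-isClassMax n p = proj₂ (proj₂ (∈SList⇒ n (∈-lookup p)))

el-increasing : ∀ n {p q} → p Fin.< q → el n p < el n q
el-increasing n = lookup-AllPairs (SList-increasing n)

dual : ∀ n → Fin (sz n) → Fin (sz n)
dual n p = Any.index (div∈SList n (el-positive n p) (el≤n n p))

el-dual : ∀ n p → el n (dual n p) ≡ div n (el n p)
el-dual n p = sym (lookup-index (div∈SList n (el-positive n p) (el≤n n p)))

dual-antitone : ∀ n {p q} → p Fin.< q → dual n q Fin.< dual n p
dual-antitone n {p} {q} p<q = cancel-< (begin-strict
  el n (dual n q)  ≡⟨ el-dual n q ⟩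
  div n (el n q)   <⟨ isClassMax⇒div-< n (el-isClassMax n p) (el-positive n p) (el-increasing n p<q) ⟩
  div n (el n p)   ≡⟨ el-dual n p ⟨
  el n (dual n p)  ∎)
  where
  open StrictlyIncreasing (el-increasing n)
  open ≤-Reasoning

Tmat-index : ∀ n i l → suc (toℕ i + toℕ l) ≤ sz n ⇔ el n i * el n l ≤ n
Tmat-index n i l = begin
  suc (toℕ i + toℕ l) ≤ sz n   ≈⟨ complement ⟩
  l Fin.≤ dual n i             ≈⟨ mk⇔ mono-≤ cancel-≤ ⟩
  el n l ≤ el n (dual n i)     ≡⟨ cong (el n l ≤_) (el-dual n i) ⟩
  el n l ≤ div n (el n i)      ≈⟨ ≤div⇔*≤ n (el-positive n i) ⟩
  el n l * el n i ≤ n          ≡⟨ cong (_≤ n) (*-comm (el n l) (el n i)) ⟩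
  el n i * el n l ≤ n          ∎
  where
  open StrictlyIncreasing (el-increasing n)
  open ⇔-Reasoning
  complement : suc (toℕ i + toℕ l) ≤ sz n ⇔ l Fin.≤ dual n i
  complement = subst (λ m → suc (toℕ i + toℕ l) ≤ m ⇔ l Fin.≤ dual n i)
    (strictlyAntitone⇒complement (dual-antitone n) i)
    (mk⇔ (+-cancelˡ-≤ (toℕ i) _ _ ∘ s≤s⁻¹) (s≤s ∘ +-monoʳ-≤ (toℕ i)))

classIdx-sound : ∀ n {m l} → classIdx n m ≡ just l → div n (el n l) ≡ div n m
classIdx-sound n {m} = findIndex-sound (λ l → div n l ≟ div n m) {SList n}

classIdx≢nothing : ∀ n {m} → 1 ≤ m → m ≤ n → classIdx n m ≢ nothing
classIdx≢nothing n {m} 1≤m m≤n = findIndex-complete (λ l → div n l ≟ div n m)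
  (lose (div∈SList n (div-positive n 1≤m m≤n) (div≤ n m)) (div-div-div n 1≤m m≤n))

basis-diag : ∀ n p → basis n p p ≡ + 1
basis-diag n p with p Fin.≟ p
... | yes _   = refl
... | no p≢p = contradiction refl p≢p

basis-off : ∀ n {p q} → p ≢ q → basis n p q ≡ + 0
basis-off n {p} {q} p≢q with p Fin.≟ q
... | yes p≡q = contradiction p≡q p≢q
... | no _    = refl

Σ-basis : ∀ n j (f : Fin (sz n) → ℤ) → Σ (sz n) (λ k → f k ℤ.* basis n j k) ≡ f j
Σ-basis n j f = trans
  (Σ-pick (sz n) j (λ k j≢k → trans (cong (f k ℤ.*_) (basis-off n j≢k)) (ℤᵖ.*-zeroʳ (f k))))
  (trans (cong (f j ℤ.*_) (basis-diag n j)) (ℤᵖ.*-identityʳ (f j)))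

ρ-entry : ∀ n a k j → ρ n a k j ≡ Σ (sz n) (λ p → a p ℤ.* basisMul n p j k)
ρ-entry n a k j = Σ-cong (sz n) λ p → trans
  (Σ-cong (sz n) (λ q → ℤ*.xy∙z≈xz∙y (a p) (basis n j q) (basisMul n p q k)))
  (Σ-basis n j (λ q → a p ℤ.* basisMul n p q k))

Tρ-entry : ∀ n a i j → matMul (sz n) (Tmat n) (ρ n a) i j
                      ≡ Σ (sz n) (λ p → a p ℤ.* Σ (sz n) (λ k → Tmat n i k ℤ.* basisMul n p j k))
Tρ-entry n a i j = begin
  Σ s (λ k → Tmat n i k ℤ.* ρ n a k j)
    ≡⟨ Σ-cong s (λ k → cong (Tmat n i k ℤ.*_) (ρ-entry n a k j)) ⟩
  Σ s (λ k → Tmat n i k ℤ.* Σ s (λ p → a p ℤ.* basisMul n p j k))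
    ≡⟨ Σ-cong s (λ k → *-distribˡ-Σ s (Tmat n i k) _) ⟩
  Σ s (λ k → Σ s (λ p → Tmat n i k ℤ.* (a p ℤ.* basisMul n p j k)))
    ≡⟨ Σ-comm s s _ ⟩
  Σ s (λ p → Σ s (λ k → Tmat n i k ℤ.* (a p ℤ.* basisMul n p j k)))
    ≡⟨ Σ-cong s (λ p → Σ-cong s (λ k → ℤ*.x∙yz≈y∙xz (Tmat n i k) (a p) _)) ⟩
  Σ s (λ p → Σ s (λ k → a p ℤ.* (Tmat n i k ℤ.* basisMul n p j k)))
    ≡⟨ Σ-cong s (λ p → *-distribˡ-Σ s (a p) _) ⟨
  Σ s (λ p → a p ℤ.* Σ s (λ k → Tmat n i k ℤ.* basisMul n p j k))
    ∎
  where
  s = sz n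
  open ≡-Reasoning

⟦_⟧ : Bool → ℤ
⟦ b ⟧ = if b then + 1 else + 0

Tmat-basisMul : ∀ n i p j → Σ (sz n) (λ k → Tmat n i k ℤ.* basisMul n p j k)
                            ≡ ⟦ does (el n p ≤? div n (el n i * el n j)) ⟧
Tmat-basisMul n i p j with el n p * el n j ≤? n
... | no pj≰n = trans (Σ-zero (sz n) (λ k → ℤᵖ.*-zeroʳ (Tmat n i k)))
                      (cong ⟦_⟧ (sym (dec-false (el n p ≤? q) (pj≰n ∘ beyond))))
  where
  open ≤-Reasoning
  q = div n (el n i * el n j)
  beyond : el n p ≤ q → el n p * el n j ≤ n
  beyond p≤q = begin
    el n p * el n j             ≤⟨ m≤n*m (el n p * el n j) (el n i) {{>-nonZero (el-positive n i)}} ⟩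
    el n i * (el n p * el n j)  ≡⟨ ℕ*.x∙yz≈y∙xz (el n i) (el n p) (el n j) ⟩
    el n p * (el n i * el n j)  ≤⟨ ≤div⇒*≤ n (el n i * el n j) p≤q ⟩
    n                           ∎
... | yes pj≤n with classIdx n (el n p * el n j) in found
...   | nothing = contradiction found (classIdx≢nothing n (el*el-positive n p j) pj≤n)
...   | just l  = trans (Σ-basis n l (Tmat n i))
                        (cong ⟦_⟧ (does-⇔ same-class (suc (toℕ i + toℕ l) ≤? sz n) (el n p ≤? q)))
  where
  open ⇔-Reasoning
  q = div n (el n i * el n j)
  same-class : suc (toℕ i + toℕ l) ≤ sz n ⇔ el n p ≤ q
  same-class = begin
    suc (toℕ i + toℕ l) ≤ sz n        ≈⟨ Tmat-index n i l ⟩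
    el n i * el n l ≤ n               ≈⟨ ≤div⇔*≤ n (el-positive n l) ⟨
    el n i ≤ div n (el n l)           ≡⟨ cong (el n i ≤_) (classIdx-sound n {el n p * el n j} found) ⟩
    el n i ≤ div n (el n p * el n j)  ≈⟨ ≤div⇔*≤ n (el*el-positive n p j) ⟩
    el n i * (el n p * el n j) ≤ n    ≡⟨ cong (_≤ n) (ℕ*.x∙yz≈y∙xz (el n i) (el n p) (el n j)) ⟩
    el n p * (el n i * el n j) ≤ n    ≈⟨ ≤div⇔*≤ n (el*el-positive n i j) ⟨
    el n p ≤ q                        ∎

jump : (g : ℕ → ℤ) (x₀ : ℕ) (xs : List ℕ) → Fin (length xs) → ℤ
jump g x₀ xs r = g (lookup xs r) - g (lookup (x₀ ∷ xs) (inject₁ r))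

telescope : (g : ℕ → ℤ) {x₀ N : ℕ} (xs : List ℕ) → AllPairs _<_ (x₀ ∷ xs) → N ∈ x₀ ∷ xs →
            Σ (length xs) (λ r → jump g x₀ xs r ℤ.* ⟦ does (lookup xs r ≤? N) ⟧) ≡ g N - g x₀
telescope g {x₀} xs (x₀<xs ∷ _) (here refl) =
  trans (Σ-zero (length xs) vanish) (sym (ℤᵖ.+-inverseʳ (g x₀)))
  where
  vanish : ∀ r → jump g x₀ xs r ℤ.* ⟦ does (lookup xs r ≤? x₀) ⟧ ≡ + 0
  vanish r = trans
    (cong (λ b → jump g x₀ xs r ℤ.* ⟦ b ⟧)
          (dec-false (lookup xs r ≤? x₀) (<⇒≱ (All.lookup x₀<xs (∈-lookup r)))))
    (ℤᵖ.*-zeroʳ (jump g x₀ xs r))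
telescope g {x₀} {N} (x ∷ xs) (_ ∷ sorted@(x<xs ∷ _)) (there N∈x∷xs) = begin
  (g x - g x₀) ℤ.* ⟦ does (x ≤? N) ⟧ ℤ.+ Σ (length xs) (λ r → jump g x xs r ℤ.* ⟦ does (lookup xs r ≤? N) ⟧)
    ≡⟨ cong₂ ℤ._+_ (cong (λ b → (g x - g x₀) ℤ.* ⟦ b ⟧) (dec-true (x ≤? N) (head≤ N∈x∷xs)))
                   (telescope g xs sorted N∈x∷xs) ⟩
  (g x - g x₀) ℤ.* + 1 ℤ.+ (g N - g x)
    ≡⟨ cancel (g x₀) (g x) (g N) ⟩
  g N - g x₀
    ∎
  where
  open ≡-Reasoning
  head≤ : ∀ {y} → y ∈ x ∷ xs → x ≤ y
  head≤ (here refl)  = ≤-refl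
  head≤ (there y∈xs) = <⇒≤ (All.lookup x<xs y∈xs)
  cancel : ∀ a b c → (b - a) ℤ.* + 1 ℤ.+ (c - b) ≡ c - a
  cancel = solve-∀

Δ : ∀ n → (ℕ → ℤ) → Elt n
Δ n g p = g (el n p) - g (pred⁻ n p)

Δ≡jump : ∀ n g p → Δ n g p ≡ jump g 0 (SList n) p
Δ≡jump n g p = cong (λ m → g (el n p) - g m) (predAt≡lookup (SList n) p)
  where
  predAt≡lookup : ∀ (xs : List ℕ) r → predAt xs r ≡ lookup (0 ∷ xs) (inject₁ r)
  predAt≡lookup (x ∷ xs) zero    = refl
  predAt≡lookup (x ∷ xs) (suc r) = refl

TρΔ : ∀ n (g : ℕ → ℤ) → g 0 ≡ + 0 →
      ∀ i j → matMul (sz n) (Tmat n) (ρ n (Δ n g)) i j ≡ g (div n (el n i * el n j))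
TρΔ n g g0≡0 i j = begin
  matMul s (Tmat n) (ρ n (Δ n g)) i j
    ≡⟨ Tρ-entry n (Δ n g) i j ⟩
  Σ s (λ p → Δ n g p ℤ.* Σ s (λ k → Tmat n i k ℤ.* basisMul n p j k))
    ≡⟨ Σ-cong s (λ p → cong₂ ℤ._*_ (Δ≡jump n g p) (Tmat-basisMul n i p j)) ⟩
  Σ s (λ p → jump g 0 (SList n) p ℤ.* ⟦ does (el n p ≤? q) ⟧)
    ≡⟨ telescope g (SList n) (All.tabulate (λ v∈S → proj₁ (∈SList⇒ n v∈S)) ∷ SList-increasing n)
                   (div∈0∷SList n (el*el-positive n i j)) ⟩
  g q - g 0  ≡⟨ cong (g q -_) g0≡0 ⟩
  g q - + 0  ≡⟨ ℤᵖ.+-identityʳ (g q) ⟩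
  g q        ∎
  where
  s = sz n
  q = div n (el n i * el n j)
  open ≡-Reasoning

proposition7 : (n : ℕ) → 1 ≤ n →
    (∀ i j → 𝒰 n i j ≡ + div n (el n i * el n j))
    × (∀ i j → 𝓜 n i j ≡ Mertens (div n (el n i * el n j)))
proposition7 n _ = TρΔ n +_ refl , TρΔ n Mertens refl
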